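{- For $n \ge 0$, let $a(n)$ be the number of compositions of $n$ that avoid the composition $34543$ (i.e. $3,4,5,4,3$). Then $$ \sum_{n=0}^{\infty} a(n)\, x^n = -\frac{1-4x+6x^{2}-4x^{3}+x^{4}+x^{16}+x^{13}-x^{14}+x^{9}-2x^{10}+x^{11}+x^{5}-3x^{6}+3x^{7}-x^{8}}{x^{18}+x^{17}-x^{16}+2x^{14}-x^{13}-2x^{11}+3x^{10}-x^{9}+2x^{8}-5x^{7}+4x^{6}-x^{5}-2x^{4}+7x^{3}-9x^{2}+5x-1} $$ as formal power series.
   Context: A composition of a non-negative integer $n$ is an ordered list $a_1 a_2 \dots a_k$ ($k\ge 0$) of positive integers with $a_1+\dots+a_k=n$; the empty composition is the unique composition of $0$. A composition $a_1\dots a_k$ includes (contains) the composition $b_1\dots b_s$ if $k \ge s$ and there is an index $i$ with $1\le i\le k-s+1$ such that $b_1\le a_i,\ b_2\le a_{i+1},\ \dots,\ b_s\le a_{i+s-1}$. It avoids $b_1\dots b_s$ if it does not include it. -}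

module Defs where

open import Data.Nat using (ℕ; zero; suc; _≤_; _<_; _∸_)
open import Data.Integer as ℤ using (ℤ; +_; -[1+_])
open import Data.List using (List; []; _∷_; _++_; length; map; upTo; foldr)
open import Data.Nat.ListAction using (sum)
open import Data.List.Relation.Unary.All using (All)
open import Data.List.Relation.Unary.Unique.Propositional using (Unique)
open import Data.List.Membership.Propositional using (_∈_)
open import Data.List.Relation.Binary.Pointwise using (Pointwise)
open import Data.Product using (Σ; ∃; _×_)
open import Function.Bundles using (_⇔_)
open import Relation.Binary.PropositionalEquality using (_≡_)
open import Relation.Nullary using (¬_)

IsComposition : ℕ → List ℕ → Set
IsComposition n c = All (λ x → 0 < x) c × sum c ≡ n

Includes : List ℕ → List ℕ → Set
Includes a b = ∃ λ p → ∃ λ m → ∃ λ s → (a ≡ p ++ m ++ s) × Pointwise _≤_ b m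

Avoids : List ℕ → List ℕ → Set
Avoids a b = ¬ Includes a b

pattern34543 : List ℕ
pattern34543 = 3 ∷ 4 ∷ 5 ∷ 4 ∷ 3 ∷ []

HasCount : (List ℕ → Set) → ℕ → Set
HasCount P k = Σ (List (List ℕ)) λ L → Unique L × (∀ c → (c ∈ L) ⇔ P c) × length L ≡ k

coeff : List ℤ → ℕ → ℤ
coeff [] _ = + 0
coeff (x ∷ xs) zero = x
coeff (x ∷ xs) (suc i) = coeff xs i

convCoeff : List ℤ → (ℕ → ℤ) → ℕ → ℤ
convCoeff d a n = foldr ℤ._+_ (+ 0) (map (λ i → coeff d i ℤ.* a (n ∸ i)) (upTo (suc n)))

-- Denominator  x^18+x^17-x^16+2x^14-x^13-2x^11+3x^10-x^9+2x^8-5x^7+4x^6-x^5-2x^4+7x^3-9x^2+5x-1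
denom : List ℤ
denom = -[1+ 0 ] ∷ + 5 ∷ -[1+ 8 ] ∷ + 7 ∷ -[1+ 1 ] ∷ -[1+ 0 ] ∷ + 4 ∷ -[1+ 4 ] ∷ + 2 ∷ -[1+ 0 ]
      ∷ + 3 ∷ -[1+ 1 ] ∷ + 0 ∷ -[1+ 0 ] ∷ + 2 ∷ + 0 ∷ -[1+ 0 ] ∷ + 1 ∷ + 1 ∷ []

-- Numerator 1-4x+6x^2-4x^3+x^4+x^16+x^13-x^14+x^9-2x^10+x^11+x^5-3x^6+3x^7-x^8
numer : List ℤ
numer = + 1 ∷ -[1+ 3 ] ∷ + 6 ∷ -[1+ 3 ] ∷ + 1 ∷ + 1 ∷ -[1+ 2 ] ∷ + 3 ∷ -[1+ 0 ] ∷ + 1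
      ∷ -[1+ 1 ] ∷ + 1 ∷ + 0 ∷ + 1 ∷ -[1+ 0 ] ∷ + 0 ∷ + 1 ∷ []

module Submission where

-- Transfer-matrix method.  Whether a composition, read part by part, contains 34543 is
-- decided by an automaton whose state is the set of suffixes of the pattern still to be
-- matched.  Parts are built in unit steps and parts of size at least 5 are indistinguishable,
-- so the avoiding compositions of n + 1 are the walks of length n from one node of a graph
-- with 30 reachable nodes.  The walk counts of all reachable nodes satisfy the recurrence
-- given by the denominator as soon as their first 19 values do, since one step of a walk is
-- a sum over successor nodes; those values, and the first 19 coefficients (the numerator),
-- are checked by evaluation.

open import Defs
open import Data.Nat using (ℕ)
open import Data.Integer using (ℤ; +_; -_)
open import Data.Product using (Σ; _×_)
open import Relation.Binary.PropositionalEquality using (_≡_)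

open import Data.Bool using (true; if_then_else_)
open import Data.Empty using (⊥; ⊥-elim)
open import Data.Unit using (⊤; tt)
open import Data.Nat as ℕ
  using (zero; suc; _+_; _∸_; _≤_; _<_; _≤?_; _<?_; _⊓_; z≤n; s≤s)
open import Data.Nat.Properties as ℕ
  using ( +-suc; +-identityʳ; +-comm; +-assoc; suc-injective; ≤-refl; ≤-trans; ≤-<-trans
        ; m<n⇒m<1+n; m∸n≤m; m≤n+m; m≢1+m+n; ≮⇒≥; m+[n∸m]≡n
        ; m⊓n≤m; ⊓-assoc; ⊓-glb; m≥n⇒m⊓n≡n; n≤1+n)
open import Data.Nat.ListAction using (sum)
import Data.Integer as ℤ
import Data.Integer.Properties as ℤ
open import Data.Integer.Tactic.RingSolver using (solve-∀)
open import Data.List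
  using (List; []; _∷_; _++_; map; length; foldr; applyUpTo; upTo; iterate; concatMap; deduplicate)
open import Data.List.Properties as List
  using (map-applyUpTo; map-cong-local; ∷-injectiveˡ; ∷-injectiveʳ; length-++; length-map)
open import Data.List.Relation.Unary.All as All using (All; []; _∷_; all?)
open import Data.List.Relation.Unary.All.Properties using (applyUpTo⁺₁; applyUpTo⁻)
open import Data.List.Relation.Unary.Any as Any using (Any; here; there)
open import Data.List.Relation.Unary.AllPairs using ([]; _∷_)
open import Data.List.Relation.Binary.Pointwise using (Pointwise; []; _∷_)
open import Data.List.Membership.Propositional using (_∈_; _∉_)
open import Data.List.Membership.Propositional.Properties using (∈-++⁻; ∈-++⁺ˡ; ∈-++⁺ʳ; ∈-map⁻; ∈-map⁺)
open import Data.List.Relation.Unary.Unique.Propositional using (Unique)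
import Data.List.Relation.Unary.Unique.Propositional.Properties as Unique
open import Data.List.Membership.DecPropositional (List.≡-dec ℕ._≟_) using () renaming (_∈?_ to _∈ₗ?_)
import Data.Product.Properties as Product
open import Data.Product using (∃₂; _,_; proj₂)
open import Data.Sum using (_⊎_; inj₁; inj₂)
open import Function using (_∘_; _⇔_; mk⇔; Equivalence)
open import Relation.Binary using (DecidableEquality)
open import Relation.Nullary using (¬_; Dec; yes; no; does; contradiction)
open import Relation.Nullary.Decidable using (from-yes)
open import Relation.Binary.PropositionalEquality using (refl; sym; trans; cong; cong₂; subst; module ≡-Reasoning)
open ≡-Reasoning

recurrence : List ℤ → (ℕ → ℤ) → ℕ → ℤ
recurrence [] f n = + 0
recurrence (d ∷ ds) f n = d ℤ.* f (length ds + n) ℤ.+ recurrence ds f n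

-- The sequences are explicit arguments here and in convCoeff-cong: solving for them by
-- unification would unfold terms such as walk counts at concrete indices.
recurrence-cong : ∀ d (f g : ℕ → ℤ) n → (∀ {k} → k < length d + n → f k ≡ g k) →
                  recurrence d f n ≡ recurrence d g n
recurrence-cong [] f g n f≡g = refl
recurrence-cong (d ∷ ds) f g n f≡g =
  cong₂ (λ u v → d ℤ.* u ℤ.+ v) (f≡g ≤-refl) (recurrence-cong ds f g n (f≡g ∘ m<n⇒m<1+n))

recurrence-suc : ∀ d (f : ℕ → ℤ) n → recurrence d (f ∘ suc) n ≡ recurrence d f (suc n)
recurrence-suc [] f n = refl
recurrence-suc (d ∷ ds) f n =
  cong₂ (λ u v → d ℤ.* u ℤ.+ v) (cong f (sym (+-suc (length ds) n))) (recurrence-suc ds f n)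

recurrence-+ : ∀ d (f g : ℕ → ℤ) n →
               recurrence d (λ k → f k ℤ.+ g k) n ≡ recurrence d f n ℤ.+ recurrence d g n
recurrence-+ [] f g n = refl
recurrence-+ (d ∷ ds) f g n
  rewrite recurrence-+ ds f g n = interchange d (f (length ds + n)) (g (length ds + n)) _ _
  where
  interchange : ∀ d a b r s → d ℤ.* (a ℤ.+ b) ℤ.+ (r ℤ.+ s) ≡ (d ℤ.* a ℤ.+ r) ℤ.+ (d ℤ.* b ℤ.+ s)
  interchange = solve-∀

recurrence-zero : ∀ d n → recurrence d (λ _ → + 0) n ≡ + 0
recurrence-zero [] n = refl
recurrence-zero (d ∷ ds) n rewrite ℤ.*-zeroʳ d = trans (ℤ.+-identityˡ _) (recurrence-zero ds n)

recurrence-sum : ∀ {A : Set} d (g : A → ℕ → ℕ) xs n →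
                 All (λ x → recurrence d (λ k → + g x k) n ≡ + 0) xs →
                 recurrence d (λ k → + sum (map (λ x → g x k) xs)) n ≡ + 0
recurrence-sum d g [] n [] = recurrence-zero d n
recurrence-sum d g (x ∷ xs) n (gx≡0 ∷ gxs≡0) = begin
  recurrence d (λ k → + (g x k + sum (map (λ x → g x k) xs))) n
    ≡⟨ recurrence-cong d _ _ n (λ {k} _ → ℤ.pos-+ (g x k) _) ⟩
  recurrence d (λ k → + g x k ℤ.+ + sum (map (λ x → g x k) xs)) n
    ≡⟨ recurrence-+ d _ _ n ⟩
  recurrence d (λ k → + g x k) n ℤ.+ recurrence d (λ k → + sum (map (λ x → g x k) xs)) n
    ≡⟨ cong₂ ℤ._+_ gx≡0 (recurrence-sum d g xs n gxs≡0) ⟩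
  + 0 ∎

convCoeff-cong : ∀ d (f g : ℕ → ℤ) n → (∀ {k} → k ≤ n → f k ≡ g k) →
                 convCoeff d f n ≡ convCoeff d g n
convCoeff-cong d f g n f≡g = cong (foldr ℤ._+_ (+ 0))
  (map-cong-local {f = λ i → coeff d i ℤ.* f (n ∸ i)} {g = λ i → coeff d i ℤ.* g (n ∸ i)}
    (applyUpTo⁺₁ (λ i → i) (suc n) (λ {i} _ → cong (coeff d i ℤ.*_) (f≡g (m∸n≤m n i)))))

convCoeff-[] : ∀ (f : ℕ → ℤ) n → convCoeff [] f n ≡ + 0
convCoeff-[] f n = sum-zeros (upTo (suc n))
  where
  sum-zeros : ∀ (is : List ℕ) → foldr ℤ._+_ (+ 0) (map (λ _ → + 0) is) ≡ + 0
  sum-zeros [] = refl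
  sum-zeros (_ ∷ is) = trans (ℤ.+-identityˡ _) (sum-zeros is)

convCoeff-∷ : ∀ d ds (f : ℕ → ℤ) n → convCoeff (d ∷ ds) f (suc n) ≡ d ℤ.* f (suc n) ℤ.+ convCoeff ds f n
convCoeff-∷ d ds f n = cong (λ ts → d ℤ.* f (suc n) ℤ.+ foldr ℤ._+_ (+ 0) ts) (begin
  map h (applyUpTo suc (suc n))   ≡⟨ map-applyUpTo suc h (suc n) ⟩
  applyUpTo (h ∘ suc) (suc n)     ≡⟨ map-applyUpTo (λ i → i) (h ∘ suc) (suc n) ⟨
  map (h ∘ suc) (upTo (suc n))    ∎)
  where
  h : ℕ → ℤ
  h i = coeff (d ∷ ds) i ℤ.* f (suc n ∸ i)

convCoeff≡recurrence : ∀ d (f : ℕ → ℤ) n → convCoeff d f (length d + n) ≡ recurrence d f (suc n)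
convCoeff≡recurrence [] f n = convCoeff-[] f n
convCoeff≡recurrence (d ∷ ds) f n = begin
  convCoeff (d ∷ ds) f (suc (length ds + n))
    ≡⟨ convCoeff-∷ d ds f (length ds + n) ⟩
  d ℤ.* f (suc (length ds + n)) ℤ.+ convCoeff ds f (length ds + n)
    ≡⟨ cong₂ (λ u v → d ℤ.* f u ℤ.+ v) (sym (+-suc (length ds) n)) (convCoeff≡recurrence ds f n) ⟩
  d ℤ.* f (length ds + suc n) ℤ.+ recurrence ds f (suc n) ∎

from-does : ∀ {A : Set} (a? : Dec A) → does a? ≡ true → A
from-does (yes a) _ = a
from-does (no _) ()

module Walks {Q : Set} (next : Q → List Q) (final : Q → ℕ) where

  walks : ℕ → Q → ℕ
  walks zero q = final q
  walks (suc k) q = sum (map (walks k) (next q))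

  Closed : List Q → Set
  Closed R = All (λ q → All (_∈ R) (next q)) R

  walks-recurrence : ∀ d {R} → Closed R →
                     (∀ {q} → q ∈ R → recurrence d (λ k → + walks k q) 0 ≡ + 0) →
                     ∀ n {q} → q ∈ R → recurrence d (λ k → + walks k q) n ≡ + 0
  walks-recurrence d closed initial zero q∈R = initial q∈R
  walks-recurrence d closed initial (suc n) {q} q∈R = begin
    recurrence d (λ k → + walks k q) (suc n)   ≡⟨ recurrence-suc d (λ k → + walks k q) n ⟨
    recurrence d (λ k → + walks (suc k) q) n   ≡⟨ recurrence-sum d (λ q′ k → walks k q′) (next q) n
                                                    (All.map (walks-recurrence d closed initial n)
                                                             (All.lookup closed q∈R)) ⟩
    + 0                                        ∎

  -- Memoised evaluation: a table lists the values of a function at the nodes of R.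
  module Tabulation (_≟_ : DecidableEquality Q) where

    open import Data.List.Membership.DecPropositional _≟_ using (_∈?_)

    explore : ℕ → List Q → List Q
    explore zero R = R
    explore (suc n) R = explore n (deduplicate _≟_ (R ++ concatMap next R))

    closed? : ∀ R → Dec (Closed R)
    closed? R = all? (λ q → all? (_∈? R) (next q)) R

    valueAt : List Q → List ℕ → Q → ℕ
    valueAt [] vs q = 0
    valueAt (r ∷ R) [] q = 0
    valueAt (r ∷ R) (v ∷ vs) q = if does (q ≟ r) then v else valueAt R vs q

    valueAt-map : ∀ (f : Q → ℕ) R {q} → q ∈ R → valueAt R (map f R) q ≡ f q
    valueAt-map f (r ∷ R) {q} q∈rR with q ≟ r | q∈rR
    ... | yes refl | _ = refl
    ... | no q≢r | here q≡r = contradiction q≡r q≢r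
    ... | no q≢r | there q∈R = valueAt-map f R q∈R

    step : List Q → List ℕ → List ℕ
    step R vs = map (λ q → sum (map (valueAt R vs) (next q))) R

    tables : List Q → ℕ → List (List ℕ)
    tables R = iterate (step R) (map final R)

    at : List (List ℕ) → ℕ → List ℕ
    at [] k = []
    at (t ∷ ts) zero = t
    at (t ∷ ts) (suc k) = at ts k

    step-walks : ∀ {R} → Closed R → ∀ {vs} j → (∀ {q} → q ∈ R → valueAt R vs q ≡ walks j q) →
                 ∀ {q} → q ∈ R → valueAt R (step R vs) q ≡ walks (suc j) q
    step-walks {R} closed {vs} j vs≡walks {q} q∈R = begin
      valueAt R (step R vs) q             ≡⟨ valueAt-map _ R q∈R ⟩
      sum (map (valueAt R vs) (next q))   ≡⟨ cong sum (map-cong-local (All.map vs≡walks (All.lookup closed q∈R))) ⟩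
      sum (map (walks j) (next q))        ∎

    iterate-walks : ∀ {R} → Closed R → ∀ n {vs} j → (∀ {q} → q ∈ R → valueAt R vs q ≡ walks j q) →
                    ∀ {k} → k < n → ∀ {q} → q ∈ R →
                    valueAt R (at (iterate (step R) vs n) k) q ≡ walks (j + k) q
    iterate-walks closed (suc n) j vs≡walks {zero} _ q∈R
      rewrite +-identityʳ j = vs≡walks q∈R
    iterate-walks closed (suc n) j vs≡walks {suc k} (s≤s k<n) q∈R
      rewrite +-suc j k = iterate-walks closed n (suc j) (step-walks closed j vs≡walks) k<n q∈R

    tables-walks : ∀ {R} → Closed R → ∀ {n k} → k < n → ∀ {q} → q ∈ R →
                   valueAt R (at (tables R n) k) q ≡ walks k q
    tables-walks {R} closed {n} = iterate-walks closed n 0 (valueAt-map final R)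

infix 4 _≼_

_≼_ : List ℕ → List ℕ → Set
[] ≼ c = ⊤
(_ ∷ _) ≼ [] = ⊥
(y ∷ b) ≼ (x ∷ c) = y ≤ x × b ≼ c

≼-++ : ∀ {b m} s → Pointwise _≤_ b m → b ≼ m ++ s
≼-++ s [] = tt
≼-++ s (y≤x ∷ b≤m) = y≤x , ≼-++ s b≤m

≼⇒dominated-prefix : ∀ b c → b ≼ c → ∃₂ λ m s → c ≡ m ++ s × Pointwise _≤_ b m
≼⇒dominated-prefix [] c _ = [] , c , refl , []
≼⇒dominated-prefix (y ∷ b) (x ∷ c) (y≤x , b≼c) with ≼⇒dominated-prefix b c b≼c
... | m , s , refl , b≤m = x ∷ m , s , refl , y≤x ∷ b≤m

≼[]⇒≡[] : ∀ {b} → b ≼ [] → b ≡ []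
≼[]⇒≡[] {[]} _ = refl

includes-∷ : ∀ {b} x c → Includes (x ∷ c) b ⇔ (b ≼ x ∷ c ⊎ Includes c b)
includes-∷ {b} x c = mk⇔ to from
  where
  to : Includes (x ∷ c) b → b ≼ x ∷ c ⊎ Includes c b
  to ([] , m , s , eq , b≤m) = inj₁ (subst (b ≼_) (sym eq) (≼-++ s b≤m))
  to (_ ∷ p , m , s , eq , b≤m) = inj₂ (p , m , s , ∷-injectiveʳ eq , b≤m)
  from : b ≼ x ∷ c ⊎ Includes c b → Includes (x ∷ c) b
  from (inj₁ b≼xc) = [] , ≼⇒dominated-prefix b (x ∷ c) b≼xc
  from (inj₂ (p , m , s , eq , b≤m)) = x ∷ p , m , s , cong (x ∷_) eq , b≤m

[]-avoids : ∀ {y b} → Avoids [] (y ∷ b)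
[]-avoids ([] , [] , _ , _ , ())
[]-avoids ([] , _ ∷ _ , _ , () , _)
[]-avoids (_ ∷ _ , _ , _ , () , _)

-- The suffixes of a pattern still to be matched by the parts to come; [] records that an
-- occurrence has already been completed.
Pending : Set
Pending = List (List ℕ)

shift : ℕ → Pending → Pending
shift x [] = []
shift x ([] ∷ Q) = [] ∷ shift x Q
shift x ((y ∷ s) ∷ Q) with y ≤? x
... | yes _ = s ∷ shift x Q
... | no _ = shift x Q

any-shift⁺ : ∀ {x c} Q → Any (_≼ x ∷ c) Q → Any (_≼ c) (shift x Q)
any-shift⁺ ([] ∷ Q) (here _) = here tt
any-shift⁺ ([] ∷ Q) (there h) = there (any-shift⁺ Q h)
any-shift⁺ {x} ((y ∷ s) ∷ Q) h with y ≤? x | h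
... | yes _ | here (_ , s≼c) = here s≼c
... | yes _ | there h′ = there (any-shift⁺ Q h′)
... | no y≰x | here (y≤x , _) = contradiction y≤x y≰x
... | no _ | there h′ = any-shift⁺ Q h′

any-shift⁻ : ∀ {x c} Q → Any (_≼ c) (shift x Q) → Any (_≼ x ∷ c) Q
any-shift⁻ ([] ∷ Q) (here _) = here tt
any-shift⁻ ([] ∷ Q) (there h) = there (any-shift⁻ Q h)
any-shift⁻ {x} ((y ∷ s) ∷ Q) h with y ≤? x | h
... | yes y≤x | here s≼c = here (y≤x , s≼c)
... | yes _ | there h′ = there (any-shift⁻ Q h′)
... | no _ | h′ = there (any-shift⁻ Q h′)

whenAlive : ∀ {A : Set} → Pending → List A → List A
whenAlive Q xs = if does ([] ∈ₗ? Q) then [] else xs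

whenAlive-∈⁻ : ∀ {A : Set} Q {xs : List A} {v} → v ∈ whenAlive Q xs → [] ∉ Q × v ∈ xs
whenAlive-∈⁻ Q v∈ with [] ∈ₗ? Q
whenAlive-∈⁻ Q () | yes _
whenAlive-∈⁻ Q v∈ | no alive = alive , v∈

whenAlive-∈⁺ : ∀ {A : Set} Q {xs : List A} {v} → [] ∉ Q → v ∈ xs → v ∈ whenAlive Q xs
whenAlive-∈⁺ Q alive v∈ with [] ∈ₗ? Q
... | yes dead = contradiction dead alive
... | no _ = v∈

whenAlive-unique : ∀ {A : Set} Q {xs : List A} → Unique xs → Unique (whenAlive Q xs)
whenAlive-unique Q xs! with [] ∈ₗ? Q
... | yes _ = []
... | no _ = xs!

module PatternAvoidance (b₀ : ℕ) (b₊ : List ℕ) where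

  b : List ℕ
  b = b₀ ∷ b₊

  advance : Pending → ℕ → Pending
  advance P x = shift x (b ∷ P)

  Completes : Pending → List ℕ → Set
  Completes P c = Any (_≼ c) P ⊎ Includes c b

  completes-∷ : ∀ P x c → Completes P (x ∷ c) ⇔ Completes (advance P x) c
  completes-∷ P x c = mk⇔ to from
    where
    to : Completes P (x ∷ c) → Completes (advance P x) c
    to (inj₁ h) = inj₁ (any-shift⁺ (b ∷ P) (there h))
    to (inj₂ inc) with Equivalence.to (includes-∷ x c) inc
    ... | inj₁ b≼xc = inj₁ (any-shift⁺ (b ∷ P) (here b≼xc))
    ... | inj₂ inc′ = inj₂ inc′
    from : Completes (advance P x) c → Completes P (x ∷ c)
    from (inj₁ h) with any-shift⁻ (b ∷ P) h
    ... | here b≼xc = inj₂ (Equivalence.from (includes-∷ x c) (inj₁ b≼xc))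
    ... | there h′ = inj₁ h′
    from (inj₂ inc) = inj₂ (Equivalence.from (includes-∷ x c) (inj₂ inc))

  completes-[] : ∀ {P} → Completes P [] → [] ∈ P
  completes-[] (inj₁ h) = Any.map (sym ∘ ≼[]⇒≡[]) h
  completes-[] (inj₂ inc) = ⊥-elim ([]-avoids inc)

  dead⇒completes : ∀ {P x c} → [] ∈ advance P x → Completes P (x ∷ c)
  dead⇒completes {P} {x} dead = Equivalence.from (completes-∷ P x _) (inj₁ (Any.map (λ { refl → tt }) dead))

  -- The first part grows one unit at a time, so that this recursion matches walks in Counting.
  extensions : Pending → ℕ → ℕ → List (List ℕ)
  extensions P x zero = whenAlive (advance P x) ((x ∷ []) ∷ [])
  extensions P x (suc m) = extensions P (suc x) m
                        ++ whenAlive (advance P x) (map (x ∷_) (extensions (advance P x) 1 m))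

  Extension : Pending → ℕ → ℕ → List ℕ → Set
  Extension P x m c = ∃₂ λ y c′ → c ≡ y + x ∷ c′ × All (0 <_) c′ × y + sum c′ ≡ m × ¬ Completes P c

  extensions-sound : ∀ P x m {c} → c ∈ extensions P x m → Extension P x m c
  extensions-sound P x zero c∈ with whenAlive-∈⁻ (advance P x) c∈
  ... | alive , here refl = 0 , [] , refl , [] , refl , alive ∘ completes-[] ∘ Equivalence.to (completes-∷ P x [])
  extensions-sound P x (suc m) c∈ with ∈-++⁻ (extensions P (suc x) m) c∈
  ... | inj₁ c∈ₗ with extensions-sound P (suc x) m c∈ₗ
  ...   | y , c′ , refl , pos , sum≡ , ¬completes =
    suc y , c′ , cong (_∷ c′) (+-suc y x) , pos , cong suc sum≡ , ¬completes
  extensions-sound P x (suc m) c∈ | inj₂ c∈ᵣ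
    with ∈-map⁻ (x ∷_) (proj₂ (whenAlive-∈⁻ (advance P x) c∈ᵣ))
  ... | c′ , c′∈ , refl with extensions-sound (advance P x) 1 m c′∈
  ...   | y , c″ , refl , pos , sum≡ , ¬completes =
    0 , (y + 1 ∷ c″) , refl , m≤n+m 1 y ∷ pos , trans (+-assoc y 1 _) (trans (+-suc y _) (cong suc sum≡)) ,
    ¬completes ∘ Equivalence.to (completes-∷ P x _)

  extensions-complete : ∀ P x m {c} → Extension P x m c → c ∈ extensions P x m
  extensions-complete P x zero (zero , [] , refl , [] , refl , ¬completes) =
    whenAlive-∈⁺ (advance P x) (¬completes ∘ dead⇒completes) (here refl)
  extensions-complete P x (suc m) (suc y , c′ , refl , pos , sum≡ , ¬completes) =
    ∈-++⁺ˡ (extensions-complete P (suc x) m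
      (y , c′ , cong (_∷ c′) (sym (+-suc y x)) , pos , suc-injective sum≡ , ¬completes))
  extensions-complete P x (suc m) (zero , suc y ∷ c″ , refl , s≤s z≤n ∷ pos , sum≡ , ¬completes) =
    ∈-++⁺ʳ (extensions P (suc x) m) (whenAlive-∈⁺ (advance P x) (¬completes ∘ dead⇒completes)
      (∈-map⁺ (x ∷_) (extensions-complete (advance P x) 1 m
        (y , c″ , cong (_∷ c″) (sym (+-comm y 1)) , pos , suc-injective sum≡ ,
         ¬completes ∘ Equivalence.from (completes-∷ P x _)))))
  extensions-complete P x zero (zero , _ ∷ _ , _ , s≤s z≤n ∷ _ , () , _)
  extensions-complete P x zero (suc y , _ , _ , _ , () , _)
  extensions-complete P x (suc m) (zero , [] , _ , _ , () , _)

  extensions-unique : ∀ P x m → Unique (extensions P x m)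
  extensions-unique P x zero = whenAlive-unique (advance P x) ([] ∷ [])
  extensions-unique P x (suc m) =
    Unique.++⁺ (extensions-unique P (suc x) m)
               (whenAlive-unique (advance P x) (Unique.map⁺ ∷-injectiveʳ (extensions-unique (advance P x) 1 m)))
               first-parts-differ
    where
    first-parts-differ : ∀ {c} → c ∈ extensions P (suc x) m
                                × c ∈ whenAlive (advance P x) (map (x ∷_) (extensions (advance P x) 1 m)) → ⊥
    first-parts-differ (c∈ₗ , c∈ᵣ)
      with extensions-sound P (suc x) m c∈ₗ | ∈-map⁻ (x ∷_) (proj₂ (whenAlive-∈⁻ (advance P x) c∈ᵣ))
    ... | y , _ , refl , _ | _ , _ , eq =
      m≢1+m+n x (trans (sym (∷-injectiveˡ eq)) (trans (+-suc y x) (cong suc (+-comm y x))))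

  compositionsAvoiding : ℕ → List (List ℕ)
  compositionsAvoiding zero = [] ∷ []
  compositionsAvoiding (suc m) = extensions [] 1 m

  compositionsAvoiding-unique : ∀ n → Unique (compositionsAvoiding n)
  compositionsAvoiding-unique zero = [] ∷ []
  compositionsAvoiding-unique (suc m) = extensions-unique [] 1 m

  ∈-compositionsAvoiding : ∀ n c → c ∈ compositionsAvoiding n ⇔ (IsComposition n c × Avoids c b)
  ∈-compositionsAvoiding zero c = mk⇔ to from
    where
    to : c ∈ compositionsAvoiding zero → IsComposition zero c × Avoids c b
    to (here refl) = ([] , refl) , []-avoids
    from : IsComposition zero c × Avoids c b → c ∈ compositionsAvoiding zero
    from (([] , refl) , _) = here refl
    from ((s≤s z≤n ∷ _ , ()) , _)
  ∈-compositionsAvoiding (suc m) c = mk⇔ to from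
    where
    to : c ∈ compositionsAvoiding (suc m) → IsComposition (suc m) c × Avoids c b
    to c∈ with extensions-sound [] 1 m c∈
    ... | y , c′ , refl , pos , sum≡ , ¬completes rewrite +-comm y 1 =
      (s≤s z≤n ∷ pos , cong suc sum≡) , ¬completes ∘ inj₂
    from : IsComposition (suc m) c × Avoids c b → c ∈ compositionsAvoiding (suc m)
    from ((_∷_ {xs = c′} (s≤s {n = y} z≤n) pos , sum≡) , avoids) = extensions-complete [] 1 m
      (y , c′ , cong (_∷ c′) (sym (+-comm y 1)) , pos , suc-injective sum≡ , λ { (inj₂ inc) → avoids inc })

  -- A node is the pending set together with the size of the part being built, capped at M:
  -- when every entry of b is at most M, parts of size at least M are indistinguishable.
  module Counting (M : ℕ) (b≤M : All (_≤ M) b) where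

    cap : ℕ → ℕ
    cap x = x ⊓ M

    Node : Set
    Node = Pending × ℕ

    close : Node → List Node
    close (P , k) = whenAlive (advance P k) ((advance P k , cap 1) ∷ [])

    next : Node → List Node
    next (P , k) = (P , cap (suc k)) ∷ close (P , k)

    final : Node → ℕ
    final q = length (close q)

    open Walks next final public

    Bounded : Pending → Set
    Bounded = All (All (_≤ M))

    shift-bounded : ∀ x {Q} → Bounded Q → Bounded (shift x Q)
    shift-bounded x [] = []
    shift-bounded x {[] ∷ Q} (_ ∷ bQ) = [] ∷ shift-bounded x bQ
    shift-bounded x {(y ∷ s) ∷ Q} ((_ ∷ bs) ∷ bQ) with y ≤? x
    ... | yes _ = bs ∷ shift-bounded x bQ
    ... | no _ = shift-bounded x bQ

    shift-cap : ∀ x {Q} → Bounded Q → shift (cap x) Q ≡ shift x Q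
    shift-cap x [] = refl
    shift-cap x {[] ∷ Q} (_ ∷ bQ) = cong ([] ∷_) (shift-cap x bQ)
    shift-cap x {(y ∷ s) ∷ Q} ((y≤M ∷ _) ∷ bQ) with y ≤? cap x | y ≤? x
    ... | yes _ | yes _ = cong (s ∷_) (shift-cap x bQ)
    ... | no _ | no _ = shift-cap x bQ
    ... | yes y≤x⊓M | no y≰x = contradiction (≤-trans y≤x⊓M (m⊓n≤m x M)) y≰x
    ... | no y≰x⊓M | yes y≤x = contradiction (⊓-glb y≤x y≤M) y≰x⊓M

    cap-suc-cap : ∀ x → cap (suc (cap x)) ≡ cap (suc x)
    cap-suc-cap x = trans (⊓-assoc (suc x) (suc M) M) (cong (suc x ⊓_) (m≥n⇒m⊓n≡n (n≤1+n M)))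

    length-extensions : ∀ P x m → Bounded P → length (extensions P x m) ≡ walks m (P , cap x)
    length-extensions P x zero bP rewrite shift-cap x (b≤M ∷ bP) with [] ∈ₗ? advance P x
    ... | yes _ = refl
    ... | no _ = refl
    length-extensions P x (suc m) bP
      rewrite length-++ (extensions P (suc x) m) {whenAlive (advance P x) (map (x ∷_) (extensions (advance P x) 1 m))}
            | cap-suc-cap x | shift-cap x (b≤M ∷ bP) | length-extensions P (suc x) m bP
            with [] ∈ₗ? advance P x
    ... | yes _ = refl
    ... | no _ = cong (walks m (P , cap (suc x)) ℕ.+_) (begin
      length (map (x ∷_) (extensions (advance P x) 1 m))
        ≡⟨ length-map (x ∷_) (extensions (advance P x) 1 m) ⟩
      length (extensions (advance P x) 1 m)
        ≡⟨ length-extensions (advance P x) 1 m (shift-bounded x (b≤M ∷ bP)) ⟩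
      walks m (advance P x , cap 1)
        ≡⟨ +-identityʳ _ ⟨
      walks m (advance P x , cap 1) + 0 ∎)

open PatternAvoidance 3 (4 ∷ 5 ∷ 4 ∷ 3 ∷ [])

b≤5 : All (_≤ 5) b
b≤5 = from-yes (all? (_≤? 5) b)

open Counting 5 b≤5

_≟_ : DecidableEquality Node
_≟_ = Product.≡-dec (List.≡-dec (List.≡-dec ℕ._≟_)) ℕ._≟_

open Tabulation _≟_
open import Data.List.Membership.DecPropositional _≟_ using (_∈?_)

start : Node
start = [] , cap 1

count : ℕ → ℕ
count n = length (compositionsAvoiding n)

count-walks : ∀ m → count (suc m) ≡ walks m start
count-walks m = length-extensions [] 1 m []

-- Opaque so that conversion checking never evaluates it; it is only unfolded by the checks below.
opaque
  reachable : List Node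
  reachable = explore 25 (start ∷ [])

tabulatedCount : List Node → List (List ℕ) → ℕ → ℕ
tabulatedCount R T zero = 1
tabulatedCount R T (suc m) = valueAt R (at T m) start

-- The tables are passed as arguments so that the evaluator computes them only once.
tabulatedRecurrence? : ∀ R T → Dec (All (λ q → recurrence denom (λ k → + valueAt R (at T k) q) 0 ≡ + 0) R)
tabulatedRecurrence? R T = all? (λ q → recurrence denom (λ k → + valueAt R (at T k) q) 0 ℤ.≟ + 0) R

tabulatedInitial? : ∀ R T →
  Dec (All (λ n → convCoeff denom (λ k → + tabulatedCount R T k) n ≡ - coeff numer n) (upTo 19))
tabulatedInitial? R T = all? (λ n → convCoeff denom (λ k → + tabulatedCount R T k) n ℤ.≟ - coeff numer n) (upTo 19)

opaque
  unfolding reachable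

  reachable-closed-checked : does (closed? reachable) ≡ true
  reachable-closed-checked = refl

  start-reachable-checked : does (start ∈? reachable) ≡ true
  start-reachable-checked = refl

  tabulatedRecurrence-checked : does (tabulatedRecurrence? reachable (tables reachable 19)) ≡ true
  tabulatedRecurrence-checked = refl

  tabulatedInitial-checked : does (tabulatedInitial? reachable (tables reachable 19)) ≡ true
  tabulatedInitial-checked = refl

reachable-closed : Closed reachable
reachable-closed = from-does (closed? reachable) reachable-closed-checked

start∈reachable : start ∈ reachable
start∈reachable = from-does (start ∈? reachable) start-reachable-checked

walks-initial : ∀ {q} → q ∈ reachable → recurrence denom (λ k → + walks k q) 0 ≡ + 0
walks-initial {q} q∈R = begin
  recurrence denom (λ k → + walks k q) 0
    ≡⟨ recurrence-cong denom (λ k → + walks k q) (λ k → + valueAt reachable (at (tables reachable 19) k) q) 0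
         (λ k<19 → cong +_ (sym (tables-walks reachable-closed {n = 19} k<19 q∈R))) ⟩
  recurrence denom (λ k → + valueAt reachable (at (tables reachable 19) k) q) 0
    ≡⟨ All.lookup (from-does (tabulatedRecurrence? reachable (tables reachable 19))
                             tabulatedRecurrence-checked) q∈R ⟩
  + 0 ∎

later-coefficients : ∀ m → convCoeff denom (λ k → + count k) (19 + m) ≡ - coeff numer (19 + m)
later-coefficients m = begin
  convCoeff denom (λ k → + count k) (19 + m)
    ≡⟨ convCoeff≡recurrence denom (λ k → + count k) m ⟩
  recurrence denom (λ k → + count k) (suc m)
    ≡⟨ recurrence-suc denom (λ k → + count k) m ⟨
  recurrence denom (λ k → + count (suc k)) m
    ≡⟨ recurrence-cong denom (λ k → + count (suc k)) (λ k → + walks k start) m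
         (λ {k} _ → cong +_ (count-walks k)) ⟩
  recurrence denom (λ k → + walks k start) m
    ≡⟨ walks-recurrence denom reachable-closed walks-initial m start∈reachable ⟩
  + 0 ∎

initial-coefficients : ∀ {n} → n < 19 → convCoeff denom (λ k → + count k) n ≡ - coeff numer n
initial-coefficients {n} n<19 = trans
  (convCoeff-cong denom (λ k → + count k) (λ k → + tabulatedCount reachable (tables reachable 19) k) n
     (λ k≤n → cong +_ (count≡tabulated (≤-<-trans k≤n n<19))))
  (applyUpTo⁻ (λ i → i) 19
     (from-does (tabulatedInitial? reachable (tables reachable 19)) tabulatedInitial-checked) n<19)
  where
  count≡tabulated : ∀ {k} → k < 19 → count k ≡ tabulatedCount reachable (tables reachable 19) k
  count≡tabulated {zero} _ = refl
  count≡tabulated {suc m} (s≤s m<18) =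
    trans (count-walks m) (sym (tables-walks reachable-closed (m<n⇒m<1+n m<18) start∈reachable))

-- Transported along n ≡ 19 + m rather than obtained by matching on it: matching leaves the
-- index normalised, and conversion could then only compare it with 19 + m by unfolding count.
coefficients : ∀ n → convCoeff denom (λ k → + count k) n ≡ - coeff numer n
coefficients n with n <? 19
... | yes n<19 = initial-coefficients n<19
... | no n≮19 = subst (λ n → convCoeff denom (λ k → + count k) n ≡ - coeff numer n)
                      (m+[n∸m]≡n (≮⇒≥ n≮19)) (later-coefficients (n ∸ 19))

theorem1 : Σ (ℕ → ℕ) λ a →
    ((n : ℕ) → HasCount (λ c → IsComposition n c × Avoids c pattern34543) (a n))
    × ((n : ℕ) → convCoeff denom (λ k → + (a k)) n ≡ - coeff numer n)
theorem1 =
  count ,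
  (λ n → compositionsAvoiding n , compositionsAvoiding-unique n , ∈-compositionsAvoiding n , refl) ,
  coefficients
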